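{- Let $a,b\in\mathbb{N}$ and let $I$ be a nonempty subset of $\{0,1,\dots,b-2\}$. Write, for complex $|x|<1$, \[ \prod_{n=1}^{\infty}(1-x^n)^{ -a}\prod_{i\in I} (1-x^{bn-i})^{a} = \sum_{n=0}^{\infty} A(n) x^n . \] Then $A(n)>0$ for all $n\in\mathbb{N}_0$.
   Context: $\mathbb{N}=\{1,2,3,\dots\}$, $\mathbb{N}_0=\{0,1,2,\dots\}$. For example, with $b=3$ this covers $\prod_{n\ge1}(1-x^n)^{ -a}(1-x^{3n})^a$, $\prod_{n\ge1}(1-x^n)^{ -a}(1-x^{3n-1})^a$ and $\prod_{n\ge1}(1-x^n)^{ -a}(1-x^{3n})^a(1-x^{3n-1})^a$. -}

module Defs where

open import Data.Nat as ℕ using (ℕ; zero; suc; _∸_)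
open import Data.Nat.Divisibility using (_∣?_)
open import Data.Integer as ℤ using (ℤ; +_; -_)
open import Data.List using (List; []; _∷_)
open import Relation.Nullary using (yes; no)

Series : Set
Series = ℕ → ℤ

one : Series
one zero    = + 1
one (suc _) = + 0

-- Cauchy product: (f * g)(n) = Σ_{k=0}^{n} f(k) g(n-k).
_⊛_ : Series → Series → Series
(f ⊛ g) zero    = f zero ℤ.* g zero
(f ⊛ g) (suc n) = f zero ℤ.* g (suc n) ℤ.+ ((λ m → f (suc m)) ⊛ g) n

pow : Series → ℕ → Series
pow f zero    = one
pow f (suc a) = f ⊛ pow f a

oneMinus : ℕ → Series
oneMinus k zero = + 1
oneMinus k (suc m) with k ℕ.≟ suc m
... | yes _ = - (+ 1)
... | no  _ = + 0

-- (1 - x^k)^{-1} = Σ_{m≥0} x^{km}  (used with k ≥ 1).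
geomInv : ℕ → Series
geomInv k m with k ∣? m
... | yes _ = + 1
... | no  _ = + 0

innerProd : ℕ → ℕ → List ℕ → Series
innerProd b n []      = one
innerProd b n (i ∷ I) = oneMinus (b ℕ.* n ∸ i) ⊛ innerProd b n I

factor : ℕ → ℕ → List ℕ → ℕ → Series
factor a b I n = pow (geomInv n) a ⊛ pow (innerProd b n I) a

partialProd : ℕ → ℕ → List ℕ → ℕ → Series
partialProd a b I zero    = one
partialProd a b I (suc N) = factor a b I (suc N) ⊛ partialProd a b I N

-- A(n): coefficient of x^n of the infinite product. Every factor with index
-- N > n is 1 + O(x^{n+1}), so the partial product up to N = n already gives it.
A : ℕ → ℕ → List ℕ → ℕ → ℤ
A a b I n = partialProd a b I n n

module Submission where

-- Up to degree N, ∏_{n≤N} (1-x^n)^{-1} agrees with ∏_{m≤bN} (1-x^m)^{-1}, whose factors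
-- group into blocks k = 1..N of the indices m = bk - j with j < b. In block k each numerator
-- factor (1-x^{bk-i}), i ∈ I, cancels the denominator with j = i, so the block is a product of
-- geometric series and has nonnegative coefficients and constant term 1. Multiplying by such
-- series never decreases a coefficient, and as b-1 ∉ I the first block contains
-- 1/(1-x) = Σ x^m; so every coefficient of the product, and of its a-th power, is at least 1.

open import Defs
open import Data.Nat using (ℕ; zero; suc; _<_; _≤_; z≤n; s≤s; _∸_; _≟_)
import Data.Nat as ℕ
import Data.Nat.Properties as ℕP
open import Data.Nat.Divisibility using (_∣_; _∣?_; _∣0; 1∣_; >⇒∤; ∣m+n∣m⇒∣n; ∣m∣n⇒∣m+n; ∣-refl)
open import Data.Integer as ℤ using (ℤ; +_; -_; _+_; _*_; +≤+; +<+) renaming (_≤_ to _≤ℤ_; _<_ to _<ℤ_)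
import Data.Integer.Properties as ℤP
open import Data.Integer.Tactic.RingSolver using (solve-∀)
open import Data.List using (List; []; _∷_)
open import Data.List.Relation.Unary.All using (All; _∷_)
import Data.List.Relation.Unary.All as All
open import Data.List.Relation.Unary.AllPairs using (_∷_)
open import Data.List.Relation.Unary.Unique.Propositional using (Unique)
open import Data.Product using (_,_)
open import Data.Sum using (_⊎_; inj₁; inj₂)
open import Data.Empty using (⊥-elim)
open import Function using (_∘_)
open import Level using (0ℓ)
open import Algebra.Bundles using (CommutativeMonoid)
open import Algebra.Structures using (IsCommutativeMonoid)
open import Relation.Binary.Bundles using (Setoid)
open import Relation.Nullary using (yes; no)
open import Relation.Binary.PropositionalEquality
  using (_≡_; _≢_; _≗_; refl; sym; trans; cong; cong₂; subst; _→-setoid_; module ≡-Reasoning)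

-- Finite products in a commutative monoid

module FiniteProducts {c ℓ} (M : CommutativeMonoid c ℓ) where
  open CommutativeMonoid M renaming (refl to ≈-refl; sym to ≈-sym; trans to ≈-trans)
  open import Algebra.Properties.CommutativeSemigroup commutativeSemigroup
    using (interchange; x∙yz≈y∙xz)
  open import Relation.Binary.Reasoning.Setoid setoid

  ∏< : (ℕ → Carrier) → ℕ → Carrier
  ∏< g zero    = ε
  ∏< g (suc b) = g b ∙ ∏< g b

  ∏⁺ : (ℕ → Carrier) → ℕ → Carrier
  ∏⁺ f N = ∏< (f ∘ suc) N

  ∏ˡ : (ℕ → Carrier) → List ℕ → Carrier
  ∏ˡ h []      = ε
  ∏ˡ h (i ∷ I) = h i ∙ ∏ˡ h I

  ∏<-cong : ∀ {g g'} b → (∀ {j} → j < b → g j ≈ g' j) → ∏< g b ≈ ∏< g' b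
  ∏<-cong zero    _ = ≈-refl
  ∏<-cong (suc b) e = ∙-cong (e ℕP.≤-refl) (∏<-cong b (e ∘ ℕP.m≤n⇒m≤1+n))

  ∏⁺-cong : ∀ {f f'} N → (∀ k → f k ≈ f' k) → ∏⁺ f N ≈ ∏⁺ f' N
  ∏⁺-cong N e = ∏<-cong N (λ {k} _ → e (suc k))

  ∏<-ε : ∀ b → ∏< (λ _ → ε) b ≈ ε
  ∏<-ε zero    = ≈-refl
  ∏<-ε (suc b) = ≈-trans (identityˡ _) (∏<-ε b)

  ∏<-distrib : ∀ g h b → ∏< (λ j → g j ∙ h j) b ≈ ∏< g b ∙ ∏< h b
  ∏<-distrib g h zero    = ≈-sym (identityˡ ε)
  ∏<-distrib g h (suc b) = ≈-trans (∙-congˡ (∏<-distrib g h b)) (interchange _ _ _ _)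

  ∏⁺-distrib : ∀ f g N → ∏⁺ (λ k → f k ∙ g k) N ≈ ∏⁺ f N ∙ ∏⁺ g N
  ∏⁺-distrib f g = ∏<-distrib (f ∘ suc) (g ∘ suc)

  ∏<-suc : ∀ g b → ∏< g (suc b) ≈ g 0 ∙ ∏< (g ∘ suc) b
  ∏<-suc g zero    = ≈-refl
  ∏<-suc g (suc b) = ≈-trans (∙-congˡ (∏<-suc g b)) (x∙yz≈y∙xz _ _ _)

  ∏⁺-+ : ∀ f b M → ∏⁺ f (b ℕ.+ M) ≈ ∏< (λ j → f (b ℕ.+ M ∸ j)) b ∙ ∏⁺ f M
  ∏⁺-+ f zero    M = ≈-sym (identityˡ _)
  ∏⁺-+ f (suc b) M = begin
    f (suc b ℕ.+ M) ∙ ∏⁺ f (b ℕ.+ M)                                ≈⟨ ∙-congˡ (∏⁺-+ f b M) ⟩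
    f (suc b ℕ.+ M) ∙ (∏< (λ j → f (b ℕ.+ M ∸ j)) b ∙ ∏⁺ f M)       ≈⟨ assoc _ _ _ ⟨
    (f (suc b ℕ.+ M) ∙ ∏< (λ j → f (b ℕ.+ M ∸ j)) b) ∙ ∏⁺ f M       ≈⟨ ∙-congʳ (∏<-suc (λ j → f (suc b ℕ.+ M ∸ j)) b) ⟨
    ∏< (λ j → f (suc b ℕ.+ M ∸ j)) (suc b) ∙ ∏⁺ f M                  ∎

  ∏⁺-* : ∀ f b N → ∏⁺ f (b ℕ.* N) ≈ ∏⁺ (λ k → ∏< (λ j → f (b ℕ.* k ∸ j)) b) N
  ∏⁺-* f b zero    = reflexive (cong (∏⁺ f) (ℕP.*-zeroʳ b))
  ∏⁺-* f b (suc N) = begin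
    ∏⁺ f (b ℕ.* suc N)                                       ≡⟨ cong (∏⁺ f) b[1+N]≡b+bN ⟩
    ∏⁺ f (b ℕ.+ b ℕ.* N)                                     ≈⟨ ∏⁺-+ f b (b ℕ.* N) ⟩
    ∏< (λ j → f (b ℕ.+ b ℕ.* N ∸ j)) b ∙ ∏⁺ f (b ℕ.* N)      ≈⟨ ∙-congˡ (∏⁺-* f b N) ⟩
    ∏< (λ j → f (b ℕ.+ b ℕ.* N ∸ j)) b ∙ ∏⁺ F N              ≡⟨ cong (λ m → ∏< (λ j → f (m ∸ j)) b ∙ ∏⁺ F N) b[1+N]≡b+bN ⟨
    ∏⁺ F (suc N)                                             ∎
    where
    F = λ k → ∏< (λ j → f (b ℕ.* k ∸ j)) b
    b[1+N]≡b+bN = ℕP.*-suc b N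

  restrict : List ℕ → (ℕ → Carrier) → ℕ → Carrier
  restrict []      h j = ε
  restrict (i ∷ I) h j with j ≟ i
  ... | yes _ = h j
  ... | no  _ = restrict I h j

  restrict-here : ∀ i I h → restrict (i ∷ I) h i ≈ h i
  restrict-here i I h with i ≟ i
  ... | yes _  = ≈-refl
  ... | no i≢i = ⊥-elim (i≢i refl)

  restrict-there : ∀ i I h {j} → j ≢ i → restrict (i ∷ I) h j ≈ restrict I h j
  restrict-there i I h {j} j≢i with j ≟ i
  ... | yes j≡i = ⊥-elim (j≢i j≡i)
  ... | no  _   = ≈-refl

  restrict-∉ : ∀ I h {j} → All (j ≢_) I → restrict I h j ≈ ε
  restrict-∉ []      h _            = ≈-refl
  restrict-∉ (i ∷ I) h (j≢i ∷ j∉I) = ≈-trans (restrict-there i I h j≢i) (restrict-∉ I h j∉I)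

  restrict-cases : ∀ I h j → restrict I h j ≈ ε ⊎ restrict I h j ≈ h j
  restrict-cases []      h j = inj₁ ≈-refl
  restrict-cases (i ∷ I) h j with j ≟ i
  ... | yes _ = inj₂ ≈-refl
  ... | no  _ = restrict-cases I h j

  ∏<-insert : ∀ b {i} → i < b → ∀ {g g' x} → g i ≈ ε → g' i ≈ x →
              (∀ {j} → j ≢ i → g' j ≈ g j) → ∏< g' b ≈ x ∙ ∏< g b
  ∏<-insert (suc b) {i} i<1+b {g} {g'} {x} gi≈ε g'i≈x g'≈g with b ≟ i
  ... | yes refl = begin
    g' b ∙ ∏< g' b  ≈⟨ ∙-cong g'i≈x (∏<-cong b (λ j<b → g'≈g (λ j≡b → ℕP.<-irrefl j≡b j<b))) ⟩
    x ∙ ∏< g b      ≈⟨ ∙-congˡ (identityˡ _) ⟨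
    x ∙ (ε ∙ ∏< g b) ≈⟨ ∙-congˡ (∙-congʳ gi≈ε) ⟨
    x ∙ (g b ∙ ∏< g b) ∎
  ... | no b≢i = begin
    g' b ∙ ∏< g' b     ≈⟨ ∙-cong (g'≈g b≢i) (∏<-insert b i<b gi≈ε g'i≈x g'≈g) ⟩
    g b ∙ (x ∙ ∏< g b) ≈⟨ x∙yz≈y∙xz _ _ _ ⟩
    x ∙ (g b ∙ ∏< g b) ∎
    where i<b = ℕP.≤∧≢⇒< (ℕP.≤-pred i<1+b) (b≢i ∘ sym)

  ∏ˡ-restrict : ∀ b h I → Unique I → All (_< b) I → ∏ˡ h I ≈ ∏< (restrict I h) b
  ∏ˡ-restrict b h []      _              _            = ≈-sym (∏<-ε b)
  ∏ˡ-restrict b h (i ∷ I) (i∉I ∷ unique) (i<b ∷ I<b) = begin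
    h i ∙ ∏ˡ h I                  ≈⟨ ∙-congˡ (∏ˡ-restrict b h I unique I<b) ⟩
    h i ∙ ∏< (restrict I h) b     ≈⟨ ∏<-insert b i<b (restrict-∉ I h i∉I) (restrict-here i I h)
                                                   (restrict-there i I h) ⟨
    ∏< (restrict (i ∷ I) h) b     ∎

-- The commutative monoid of formal power series

tail : Series → Series
tail f m = f (suc m)

infix 4 _≈[_]_
_≈[_]_ : Series → ℕ → Series → Set
f ≈[ n ] g = ∀ {k} → k ≤ n → f k ≡ g k

⊛-coeff-cong : ∀ n {f f' g g'} → f ≈[ n ] f' → g ≈[ n ] g' → (f ⊛ g) n ≡ (f' ⊛ g') n
⊛-coeff-cong zero    f≈f' g≈g' = cong₂ _*_ (f≈f' z≤n) (g≈g' z≤n)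
⊛-coeff-cong (suc n) f≈f' g≈g' =
  cong₂ _+_ (cong₂ _*_ (f≈f' z≤n) (g≈g' ℕP.≤-refl))
            (⊛-coeff-cong n (λ k≤n → f≈f' (s≤s k≤n)) (λ k≤n → g≈g' (ℕP.m≤n⇒m≤1+n k≤n)))

⊛-cong-≈[] : ∀ {n f f' g g'} → f ≈[ n ] f' → g ≈[ n ] g' → f ⊛ g ≈[ n ] f' ⊛ g'
⊛-cong-≈[] f≈f' g≈g' {k} k≤n =
  ⊛-coeff-cong k (λ j≤k → f≈f' (ℕP.≤-trans j≤k k≤n)) (λ j≤k → g≈g' (ℕP.≤-trans j≤k k≤n))

⊛-cong : ∀ {f f' g g'} → f ≗ f' → g ≗ g' → f ⊛ g ≗ f' ⊛ g'
⊛-cong f≗f' g≗g' n = ⊛-coeff-cong n (λ {k} _ → f≗f' k) (λ {k} _ → g≗g' k)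

⊛-sucʳ : ∀ f g n → (f ⊛ g) (suc n) ≡ (f ⊛ tail g) n + f (suc n) * g 0
⊛-sucʳ f g zero    = refl
⊛-sucʳ f g (suc n) =
  trans (cong (_+_ (f 0 * g (suc (suc n)))) (⊛-sucʳ (tail f) g n))
        (sym (ℤP.+-assoc (f 0 * g (suc (suc n))) _ _))

⊛-comm : ∀ f g → f ⊛ g ≗ g ⊛ f
⊛-comm f g zero    = ℤP.*-comm (f 0) (g 0)
⊛-comm f g (suc n) = begin
  f 0 * g (suc n) + (tail f ⊛ g) n   ≡⟨ cong₂ _+_ (ℤP.*-comm (f 0) (g (suc n))) (⊛-comm (tail f) g n) ⟩
  g (suc n) * f 0 + (g ⊛ tail f) n   ≡⟨ ℤP.+-comm (g (suc n) * f 0) ((g ⊛ tail f) n) ⟩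
  (g ⊛ tail f) n + g (suc n) * f 0   ≡⟨ ⊛-sucʳ g f n ⟨
  (g ⊛ f) (suc n)                        ∎
  where open ≡-Reasoning

⊛-distribʳ-+ : ∀ f f' h n → ((λ m → f m + f' m) ⊛ h) n ≡ (f ⊛ h) n + (f' ⊛ h) n
⊛-distribʳ-+ f f' h zero    = ℤP.*-distribʳ-+ (h 0) (f 0) (f' 0)
⊛-distribʳ-+ f f' h (suc n) =
  trans (cong (_+_ ((f 0 + f' 0) * h (suc n))) (⊛-distribʳ-+ (tail f) (tail f') h n))
        (regroup (f 0) (f' 0) (h (suc n)) _ _)
  where
  regroup : ∀ a b c x y → (a + b) * c + (x + y) ≡ (a * c + x) + (b * c + y)
  regroup = solve-∀

⊛-scaleˡ : ∀ c f h n → ((λ m → c * f m) ⊛ h) n ≡ c * (f ⊛ h) n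
⊛-scaleˡ c f h zero    = ℤP.*-assoc c (f 0) (h 0)
⊛-scaleˡ c f h (suc n) =
  trans (cong (_+_ ((c * f 0) * h (suc n))) (⊛-scaleˡ c (tail f) h n))
        (factor-out c (f 0) (h (suc n)) _)
  where
  factor-out : ∀ c a b x → (c * a) * b + c * x ≡ c * (a * b + x)
  factor-out = solve-∀

⊛-assoc : ∀ f g h → (f ⊛ g) ⊛ h ≗ f ⊛ (g ⊛ h)
⊛-assoc f g h zero    = ℤP.*-assoc (f 0) (g 0) (h 0)
⊛-assoc f g h (suc n) = begin
  (f 0 * g 0) * h (suc n) + (tail (f ⊛ g) ⊛ h) n
    ≡⟨ cong (_+_ ((f 0 * g 0) * h (suc n))) (⊛-distribʳ-+ (λ m → f 0 * g (suc m)) (tail f ⊛ g) h n) ⟩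
  (f 0 * g 0) * h (suc n) + (((λ m → f 0 * g (suc m)) ⊛ h) n + ((tail f ⊛ g) ⊛ h) n)
    ≡⟨ cong (_+_ ((f 0 * g 0) * h (suc n))) (cong₂ _+_ (⊛-scaleˡ (f 0) (tail g) h n) (⊛-assoc (tail f) g h n)) ⟩
  (f 0 * g 0) * h (suc n) + (f 0 * (tail g ⊛ h) n + (tail f ⊛ (g ⊛ h)) n)
    ≡⟨ regroup (f 0) (g 0) (h (suc n)) _ _ ⟩
  f 0 * (g 0 * h (suc n) + (tail g ⊛ h) n) + (tail f ⊛ (g ⊛ h)) n
    ∎
  where
  open ≡-Reasoning
  regroup : ∀ a b c x y → (a * b) * c + (a * x + y) ≡ a * (b * c + x) + y
  regroup = solve-∀

⊛-vanishingˡ : ∀ d g → (∀ l → d l ≡ + 0) → ∀ n → (d ⊛ g) n ≡ + 0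
⊛-vanishingˡ d g d≡0 zero    rewrite d≡0 0 = refl
⊛-vanishingˡ d g d≡0 (suc n) rewrite d≡0 0 | ⊛-vanishingˡ (tail d) g (d≡0 ∘ suc) n = refl

⊛-identityˡ : ∀ g → one ⊛ g ≗ g
⊛-identityˡ g zero    = ℤP.*-identityˡ (g 0)
⊛-identityˡ g (suc n) rewrite ⊛-vanishingˡ (tail one) g (λ _ → refl) n =
  trans (ℤP.+-identityʳ _) (ℤP.*-identityˡ (g (suc n)))

⊛-identityʳ : ∀ g → g ⊛ one ≗ g
⊛-identityʳ g n = trans (⊛-comm g one n) (⊛-identityˡ g n)

⊛-isCommutativeMonoid : IsCommutativeMonoid _≗_ _⊛_ one
⊛-isCommutativeMonoid = record
  { isMonoid = record
    { isSemigroup = record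
      { isMagma = record
        { isEquivalence = Setoid.isEquivalence (ℕ →-setoid ℤ)
        ; ∙-cong        = ⊛-cong
        }
      ; assoc = ⊛-assoc
      }
    ; identity = ⊛-identityˡ , ⊛-identityʳ
    }
  ; comm = ⊛-comm
  }

⊛-commutativeMonoid : CommutativeMonoid 0ℓ 0ℓ
⊛-commutativeMonoid = record { isCommutativeMonoid = ⊛-isCommutativeMonoid }

open FiniteProducts ⊛-commutativeMonoid

module ≗ = Setoid (ℕ →-setoid ℤ)
open import Algebra.Properties.CommutativeSemigroup
  (CommutativeMonoid.commutativeSemigroup ⊛-commutativeMonoid) using (interchange)

pow-one : ∀ a → pow one a ≗ one
pow-one zero    = ≗.refl
pow-one (suc a) = ≗.trans (⊛-cong ≗.refl (pow-one a)) (⊛-identityˡ one)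

pow-distrib : ∀ f g a → pow (f ⊛ g) a ≗ pow f a ⊛ pow g a
pow-distrib f g zero    = ≗.sym (⊛-identityˡ one)
pow-distrib f g (suc a) = ≗.trans (⊛-cong ≗.refl (pow-distrib f g a)) (interchange f g _ _)

-- Geometric series

geomInv-zero : ∀ k → geomInv k 0 ≡ + 1
geomInv-zero k with k ∣? 0
... | yes _   = refl
... | no  k∤0 = ⊥-elim (k∤0 (k ∣0))

geomInv-one : ∀ m → geomInv 1 m ≡ + 1
geomInv-one m with 1 ∣? m
... | yes _   = refl
... | no  1∤m = ⊥-elim (1∤m (1∣ m))

geomInv-below : ∀ k m → suc m < k → geomInv k (suc m) ≡ + 0
geomInv-below k m 1+m<k with k ∣? suc m
... | yes k∣1+m = ⊥-elim (>⇒∤ 1+m<k k∣1+m)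
... | no  _     = refl

geomInv-periodic : ∀ k m → geomInv k (m ℕ.+ k) ≡ geomInv k m
geomInv-periodic k m with k ∣? m ℕ.+ k | k ∣? m
... | yes _  | yes _  = refl
... | no  _  | no  _  = refl
... | yes k∣m+k | no k∤m = ⊥-elim (k∤m (∣m+n∣m⇒∣n (subst (k ∣_) (ℕP.+-comm m k) k∣m+k) ∣-refl))
... | no k∤m+k  | yes k∣m = ⊥-elim (k∤m+k (∣m∣n⇒∣m+n k∣m ∣-refl))

geomInv-nonneg : ∀ k m → + 0 ≤ℤ geomInv k m
geomInv-nonneg k m with k ∣? m
... | yes _ = +≤+ z≤n
... | no  _ = +≤+ z≤n

oneMinus-self : ∀ p → oneMinus (suc p) (suc p) ≡ - + 1
oneMinus-self p with suc p ≟ suc p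
... | yes _  = refl
... | no p≢p = ⊥-elim (p≢p refl)

oneMinus-other : ∀ p {l} → l ≢ p → oneMinus (suc p) (suc l) ≡ + 0
oneMinus-other p {l} l≢p with suc p ≟ suc l
... | yes p≡l = ⊥-elim (l≢p (sym (ℕP.suc-injective p≡l)))
... | no  _   = refl

⊛-monomialˡ-below : ∀ d g {p} → (∀ {l} → l ≢ p → d l ≡ + 0) → ∀ {m} → m < p → (d ⊛ g) m ≡ + 0
⊛-monomialˡ-below d g d≡0 {zero} 0<p rewrite d≡0 (λ 0≡p → ℕP.<-irrefl 0≡p 0<p) = refl
⊛-monomialˡ-below d g {suc p} d≡0 {suc m} (s≤s m<p)
  rewrite d≡0 {0} (λ ()) | ⊛-monomialˡ-below (tail d) g (λ l≢p → d≡0 (l≢p ∘ ℕP.suc-injective)) m<p = refl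

⊛-monomialˡ-above : ∀ d g {p} → (∀ {l} → l ≢ p → d l ≡ + 0) → ∀ {m} → p ≤ m → (d ⊛ g) m ≡ d p * g (m ∸ p)
⊛-monomialˡ-above d g {zero} d≡0 {zero} _ = refl
⊛-monomialˡ-above d g {zero} d≡0 {suc m} _
  rewrite ⊛-vanishingˡ (tail d) g (λ _ → d≡0 (λ ())) m = ℤP.+-identityʳ _
⊛-monomialˡ-above d g {suc p} d≡0 {suc m} (s≤s p≤m)
  rewrite d≡0 {0} (λ ()) | ⊛-monomialˡ-above (tail d) g (λ l≢p → d≡0 (l≢p ∘ ℕP.suc-injective)) p≤m =
  ℤP.+-identityˡ _

oneMinus-⊛-geomInv : ∀ p → oneMinus (suc p) ⊛ geomInv (suc p) ≗ one
oneMinus-⊛-geomInv p zero    = trans (ℤP.*-identityˡ _) (geomInv-zero (suc p))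
oneMinus-⊛-geomInv p (suc m) with ℕP.≤-<-connex p m
... | inj₁ p≤m = begin
  + 1 * G (suc m) + (tail (oneMinus (suc p)) ⊛ G) m
    ≡⟨ cong (_+_ (+ 1 * G (suc m))) (⊛-monomialˡ-above (tail (oneMinus (suc p))) G (oneMinus-other p) p≤m) ⟩
  + 1 * G (suc m) + oneMinus (suc p) (suc p) * G (m ∸ p)
    ≡⟨ cong₂ (λ x y → + 1 * x + y * G (m ∸ p)) G[1+m]≡G[m∸p] (oneMinus-self p) ⟩
  + 1 * G (m ∸ p) + - + 1 * G (m ∸ p)
    ≡⟨ x-x≡0 (G (m ∸ p)) ⟩
  + 0 ∎
  where
  open ≡-Reasoning
  G = geomInv (suc p)
  G[1+m]≡G[m∸p] : G (suc m) ≡ G (m ∸ p)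
  G[1+m]≡G[m∸p] = trans (cong G (sym (trans (ℕP.+-suc (m ∸ p) p) (cong suc (ℕP.m∸n+n≡m p≤m)))))
                        (geomInv-periodic (suc p) (m ∸ p))
  x-x≡0 : ∀ x → + 1 * x + - + 1 * x ≡ + 0
  x-x≡0 = solve-∀
... | inj₂ m<p
  rewrite ⊛-monomialˡ-below (tail (oneMinus (suc p))) (geomInv (suc p)) (oneMinus-other p) m<p
        | geomInv-below (suc p) m (s≤s m<p) = refl

geomInv-⊛-oneMinus : ∀ {k} → 0 < k → geomInv k ⊛ oneMinus k ≗ one
geomInv-⊛-oneMinus {suc p} _ = ≗.trans (⊛-comm _ _) (oneMinus-⊛-geomInv p)

-- Series with nonnegative coefficients

Nonneg : Series → Set
Nonneg f = ∀ m → + 0 ≤ℤ f m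

record Nonneg₁ (f : Series) : Set where
  field
    nonneg   : Nonneg f
    constant : f 0 ≡ + 1
open Nonneg₁

0≤* : ∀ {x y} → + 0 ≤ℤ x → + 0 ≤ℤ y → + 0 ≤ℤ x * y
0≤* {+ m} {+ n} _ _ = subst (+ 0 ≤ℤ_) (ℤP.pos-* m n) (+≤+ z≤n)

⊛-nonneg : ∀ {f g} → Nonneg f → Nonneg g → Nonneg (f ⊛ g)
⊛-nonneg f≥0 g≥0 zero    = 0≤* (f≥0 0) (g≥0 0)
⊛-nonneg f≥0 g≥0 (suc n) = ℤP.+-mono-≤ (0≤* (f≥0 0) (g≥0 (suc n))) (⊛-nonneg (f≥0 ∘ suc) g≥0 n)

g≤f⊛g : ∀ {f g} → Nonneg₁ f → Nonneg g → ∀ n → g n ≤ℤ (f ⊛ g) n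
g≤f⊛g {g = g} F g≥0 zero    rewrite constant F = ℤP.≤-reflexive (sym (ℤP.*-identityˡ (g 0)))
g≤f⊛g {g = g} F g≥0 (suc n) rewrite constant F | ℤP.*-identityˡ (g (suc n)) =
  ℤP.≤-trans (ℤP.≤-reflexive (sym (ℤP.+-identityʳ (g (suc n)))))
             (ℤP.+-monoʳ-≤ (g (suc n)) (⊛-nonneg (nonneg F ∘ suc) g≥0 n))

f≤f⊛g : ∀ {f g} → Nonneg f → Nonneg₁ g → ∀ n → f n ≤ℤ (f ⊛ g) n
f≤f⊛g {f} {g} f≥0 G n = subst (f n ≤ℤ_) (⊛-comm g f n) (g≤f⊛g G f≥0 n)

Nonneg₁-resp : ∀ {f g} → f ≗ g → Nonneg₁ f → Nonneg₁ g
Nonneg₁-resp f≗g F = record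
  { nonneg   = λ m → subst (+ 0 ≤ℤ_) (f≗g m) (nonneg F m)
  ; constant = trans (sym (f≗g 0)) (constant F)
  }

one-nonneg₁ : Nonneg₁ one
one-nonneg₁ = record { nonneg = λ { zero → +≤+ z≤n ; (suc _) → +≤+ z≤n } ; constant = refl }

⊛-nonneg₁ : ∀ {f g} → Nonneg₁ f → Nonneg₁ g → Nonneg₁ (f ⊛ g)
⊛-nonneg₁ F G = record
  { nonneg = ⊛-nonneg (nonneg F) (nonneg G) ; constant = cong₂ _*_ (constant F) (constant G) }

pow-nonneg₁ : ∀ {f} a → Nonneg₁ f → Nonneg₁ (pow f a)
pow-nonneg₁ zero    F = one-nonneg₁
pow-nonneg₁ (suc a) F = ⊛-nonneg₁ F (pow-nonneg₁ a F)

∏<-nonneg₁ : ∀ {g} b → (∀ {j} → j < b → Nonneg₁ (g j)) → Nonneg₁ (∏< g b)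
∏<-nonneg₁ zero    _ = one-nonneg₁
∏<-nonneg₁ (suc b) G = ⊛-nonneg₁ (G ℕP.≤-refl) (∏<-nonneg₁ b (G ∘ ℕP.m≤n⇒m≤1+n))

geomInv-nonneg₁ : ∀ k → Nonneg₁ (geomInv k)
geomInv-nonneg₁ k = record { nonneg = geomInv-nonneg k ; constant = geomInv-zero k }

f≤pow : ∀ {f} → Nonneg₁ f → ∀ a n → f n ≤ℤ pow f (suc a) n
f≤pow F a = f≤f⊛g (nonneg F) (pow-nonneg₁ a F)

factor≤∏< : ∀ {g} b → (∀ {j} → j < b → Nonneg₁ (g j)) → ∀ {j} → j < b → ∀ n → g j n ≤ℤ ∏< g b n
factor≤∏< {g} (suc b) G {j} j<1+b n with j ≟ b
... | yes refl = f≤f⊛g (nonneg (G ℕP.≤-refl)) (∏<-nonneg₁ b (G ∘ ℕP.m≤n⇒m≤1+n)) n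
... | no  j≢b  =
  ℤP.≤-trans (factor≤∏< b G′ j<b n) (g≤f⊛g (G ℕP.≤-refl) (nonneg (∏<-nonneg₁ b G′)) n)
  where
  G′ : ∀ {i} → i < b → Nonneg₁ (g i)
  G′ = G ∘ ℕP.m≤n⇒m≤1+n
  j<b = ℕP.≤∧≢⇒< (ℕP.≤-pred j<1+b) j≢b

-- Agreement up to a given degree

pow-cong-≈[] : ∀ {n f g} a → f ≈[ n ] g → pow f a ≈[ n ] pow g a
pow-cong-≈[] zero    f≈g = λ _ → refl
pow-cong-≈[] (suc a) f≈g = ⊛-cong-≈[] f≈g (pow-cong-≈[] a f≈g)

geomInv-≈[]-one : ∀ {n m} → n < m → geomInv m ≈[ n ] one
geomInv-≈[]-one {m = m} n<m {zero}  _      = geomInv-zero m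
geomInv-≈[]-one {m = m} n<m {suc k} 1+k≤n = geomInv-below m k (ℕP.<-≤-trans (s≤s 1+k≤n) n<m)

∏⁺-stable : ∀ {n f} → (∀ {m} → n < m → f m ≈[ n ] one) → ∀ {M} → n ≤ M → ∏⁺ f M ≈[ n ] ∏⁺ f n
∏⁺-stable {n} {f} f≈one n≤M = stable (ℕP.≤⇒≤′ n≤M)
  where
  stable : ∀ {M} → n ℕ.≤′ M → ∏⁺ f M ≈[ n ] ∏⁺ f n
  stable ℕ.≤′-refl          = λ _ → refl
  stable (ℕ.≤′-step n≤′M) k≤n =
    trans (⊛-cong-≈[] (f≈one (s≤s (ℕP.≤′⇒≤ n≤′M))) (stable n≤′M) k≤n) (⊛-identityˡ (∏⁺ f n) _)

-- Regrouping the product into blocks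

partialProd≗pow : ∀ a b I N → partialProd a b I N ≗ pow (∏⁺ (λ k → geomInv k ⊛ innerProd b k I) N) a
partialProd≗pow a b I zero    = ≗.sym (pow-one a)
partialProd≗pow a b I (suc N) = ≗.trans
  (⊛-cong (≗.sym (pow-distrib (geomInv (suc N)) (innerProd b (suc N) I) a)) (partialProd≗pow a b I N))
  (≗.sym (pow-distrib _ _ a))

innerProd≗∏ˡ : ∀ b n I → innerProd b n I ≗ ∏ˡ (λ i → oneMinus (b ℕ.* n ∸ i)) I
innerProd≗∏ˡ b n []      = ≗.refl
innerProd≗∏ˡ b n (i ∷ I) = ⊛-cong ≗.refl (innerProd≗∏ˡ b n I)

module Blocks (b′ : ℕ) (I : List ℕ) (unique : Unique I) (I<b′ : All (_< b′) I) where

  b : ℕ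
  b = suc b′

  numerator : ℕ → ℕ → Series
  numerator k i = oneMinus (b ℕ.* k ∸ i)

  blockFactor : ℕ → ℕ → Series
  blockFactor k j = geomInv (b ℕ.* k ∸ j) ⊛ restrict I (numerator k) j

  block : ℕ → Series
  block k = ∏< (blockFactor k) b

  innerProd≗∏< : ∀ k → innerProd b k I ≗ ∏< (restrict I (numerator k)) b
  innerProd≗∏< k = ≗.trans (innerProd≗∏ˡ b k I) (∏ˡ-restrict b (numerator k) I unique (All.map ℕP.m≤n⇒m≤1+n I<b′))

  ∏⁺-factor≈∏⁺-block : ∀ N → ∏⁺ (λ k → geomInv k ⊛ innerProd b k I) N ≈[ N ] ∏⁺ block N
  ∏⁺-factor≈∏⁺-block N {m} m≤N = begin
    ∏⁺ (λ k → geomInv k ⊛ innerProd b k I) N m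
      ≡⟨ ∏⁺-distrib geomInv (λ k → innerProd b k I) N m ⟩
    (∏⁺ geomInv N ⊛ ∏⁺ (λ k → innerProd b k I) N) m
      ≡⟨ ⊛-cong-≈[] (λ k≤N → sym (∏⁺-stable geomInv-≈[]-one (ℕP.m≤n*m N b) k≤N)) (λ _ → refl) m≤N ⟩
    (∏⁺ geomInv (b ℕ.* N) ⊛ ∏⁺ (λ k → innerProd b k I) N) m
      ≡⟨ ⊛-cong (∏⁺-* geomInv b N) (∏⁺-cong N innerProd≗∏<) m ⟩
    (∏⁺ denominators N ⊛ ∏⁺ numerators N) m
      ≡⟨ ∏⁺-distrib denominators numerators N m ⟨
    ∏⁺ (λ k → denominators k ⊛ numerators k) N m
      ≡⟨ ∏⁺-cong N (λ k → ∏<-distrib (λ j → geomInv (b ℕ.* k ∸ j)) (restrict I (numerator k)) b) m ⟨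
    ∏⁺ block N m
      ∎
    where
    open ≡-Reasoning
    denominators numerators : ℕ → Series
    denominators k = ∏< (λ j → geomInv (b ℕ.* k ∸ j)) b
    numerators   k = ∏< (restrict I (numerator k)) b

  blockFactor-nonneg₁ : ∀ k {j} → j < b → Nonneg₁ (blockFactor (suc k) j)
  blockFactor-nonneg₁ k {j} j<b with restrict-cases I (numerator (suc k)) j
  ... | inj₁ r≗one = Nonneg₁-resp (≗.trans (≗.sym (⊛-identityʳ _)) (⊛-cong ≗.refl (≗.sym r≗one)))
                                  (geomInv-nonneg₁ _)
  ... | inj₂ r≗num = Nonneg₁-resp (≗.trans (≗.sym (geomInv-⊛-oneMinus 0<bk∸j)) (⊛-cong ≗.refl (≗.sym r≗num)))
                                  one-nonneg₁
    where 0<bk∸j = ℕP.m<n⇒0<n∸m (ℕP.<-≤-trans j<b (ℕP.m≤m*n b (suc k)))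

  block-nonneg₁ : ∀ k → Nonneg₁ (block (suc k))
  block-nonneg₁ k = ∏<-nonneg₁ b (blockFactor-nonneg₁ k)

  blockFactor₁-top : blockFactor 1 b′ ≗ geomInv 1
  blockFactor₁-top = ≗.trans (⊛-cong (λ m → cong (λ z → geomInv z m) b*1∸b′≡1) (restrict-∉ I _ b′∉I))
                             (⊛-identityʳ (geomInv 1))
    where
    b*1∸b′≡1 : b ℕ.* 1 ∸ b′ ≡ 1
    b*1∸b′≡1 = trans (cong (_∸ b′) (ℕP.*-identityʳ b)) (ℕP.m+n∸n≡m 1 b′)
    b′∉I : All (b′ ≢_) I
    b′∉I = All.map (λ i<b′ b′≡i → ℕP.<-irrefl (sym b′≡i) i<b′) I<b′

  A-positive : ∀ a′ n → + 0 <ℤ A (suc a′) b I (suc n)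
  A-positive a′ n = begin-strict
    + 0                              <⟨ +<+ (s≤s z≤n) ⟩
    + 1                              ≡⟨ geomInv-one N ⟨
    geomInv 1 N                      ≡⟨ blockFactor₁-top N ⟨
    blockFactor 1 b′ N               ≤⟨ factor≤∏< {blockFactor 1} b (blockFactor-nonneg₁ 0) ℕP.≤-refl N ⟩
    block 1 N                        ≤⟨ factor≤∏< {block ∘ suc} N (λ _ → block-nonneg₁ _) (s≤s z≤n) N ⟩
    ∏⁺ block N N                     ≤⟨ f≤pow (∏<-nonneg₁ {block ∘ suc} N (λ _ → block-nonneg₁ _)) a′ N ⟩
    pow (∏⁺ block N) a N             ≡⟨ pow-cong-≈[] a (∏⁺-factor≈∏⁺-block N) ℕP.≤-refl ⟨
    pow (∏⁺ (λ k → geomInv k ⊛ innerProd b k I) N) a N ≡⟨ partialProd≗pow a b I N N ⟨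
    A a b I N                        ∎
    where
    open ℤP.≤-Reasoning
    N = suc n
    a = suc a′

theorem5p1 : (a b : ℕ) → 1 ≤ a → (I : List ℕ) → Unique I →
    All (λ i → suc i < b) I → I ≢ [] →
    (n : ℕ) → + 0 <ℤ A a b I n
theorem5p1 a        b        _  I       _      _        _    zero    = +<+ (s≤s z≤n)
theorem5p1 (suc a′) (suc b′) _  I       unique I<b      _    (suc n) =
  Blocks.A-positive b′ I unique (All.map ℕP.≤-pred I<b) a′ n
theorem5p1 zero     _        () _       _      _        _    (suc n)
theorem5p1 (suc a′) zero     _  []      _      _        I≢[] (suc n) = ⊥-elim (I≢[] refl)
theorem5p1 (suc a′) zero     _  (_ ∷ _) _      (() ∷ _) _    (suc n)
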